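{- For any positive integers $k,r$, in $\mathscr{S}$ we have $$(r)^{\ast k}=\sum_{l=1}^k\sum_{\substack{a_1+\cdots+a_l=k\\ a_i>0}}\frac{k!}{a_1!\cdots a_l!}(ra_1,\ldots,ra_l),$$ and $$(-r)^{\ast k}=\sum_{l=1}^k\sum_{\substack{a_1+\cdots+a_l=k\\ a_i>0}}\frac{k!}{a_1!\cdots a_l!}(\widetilde{ra_1},\ldots,\widetilde{ra_l}),$$ where $\widetilde{ra_i}=ra_i$ if $a_i$ is even and $\widetilde{ra_i}=-ra_i$ if $a_i$ is odd, and $\alpha^{\ast k}$ denotes the $k$-fold harmonic product $\alpha\ast\cdots\ast\alpha$.
   Context: Let $\mathscr{S}$ be the free abelian group generated by all finite sequences of nonzero integers, including the empty sequence $1$. Concatenation is extended bilinearly; $(k,\alpha)$ denotes concatenation of $(k)$ with $\alpha$. The harmonic product $\ast$ on $\mathscr{S}$ is the bilinear product defined by $1\ast\alpha=\alpha\ast1=\alpha$ and $(k,\alpha)\ast(l,\beta)=(k,\alpha\ast(l,\beta))+(l,(k,\alpha)\ast\beta)+(p(k,l),\alpha\ast\beta)$ for nonzero integers $k,l$ and sequences $\alpha,\beta$, where $p(k,l)=\operatorname{sgn}(k)\operatorname{sgn}(l)(|k|+|l|)$. -}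

module Defs where

open import Data.Nat as ℕ using (ℕ; zero; suc; _!; NonZero)
open import Data.Nat.Properties using (_!≢0; m*n≢0)
open import Data.Nat.DivMod using (_/_)
open import Data.Nat.Divisibility using (_∣?_)
open import Data.Integer as ℤ using (ℤ; +_; -_; sign; ∣_∣; _◃_)
open import Data.Sign as Sign using ()
open import Data.List using (List; []; _∷_; _++_; map; concatMap; concat; upTo; filter; foldr)
open import Data.Nat.ListAction using (sum)
open import Data.List.Base using (length)
open import Data.Product using (_×_; _,_)
open import Data.Bool using (Bool; true; false; if_then_else_)
open import Relation.Nullary.Decidable using (does)
open import Relation.Binary.PropositionalEquality using (_≡_)

-- Words: finite sequences of integers (the generators of 𝒮 are those
-- with nonzero entries; the empty list is the empty sequence 1).

Word : Set
Word = List ℤ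

p : ℤ → ℤ → ℤ
p k l = (sign k Sign.* sign l) ◃ (∣ k ∣ ℕ.+ ∣ l ∣)

-- harmonic product of two words, as a list (multiset) of words,
-- each occurring with coefficient 1
_⊛_ : Word → Word → List Word
[] ⊛ β = β ∷ []
(k ∷ α) ⊛ [] = (k ∷ α) ∷ []
(k ∷ α) ⊛ (l ∷ β) =
  map (k ∷_) (α ⊛ (l ∷ β)) ++
  map (l ∷_) ((k ∷ α) ⊛ β) ++
  map (p k l ∷_) (α ⊛ β)

-- Elements of the free abelian group 𝒮: finite formal ℤ-linear
-- combinations of words, compared via their coefficient functions.

S : Set
S = List (ℤ × Word)

_≟w_ : (u v : Word) → Bool
[] ≟w [] = true
[] ≟w (_ ∷ _) = false
(_ ∷ _) ≟w [] = false
(a ∷ u) ≟w (b ∷ v) = if does (a ℤ.≟ b) then u ≟w v else false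

coeff : S → Word → ℤ
coeff [] w = + 0
coeff ((c , u) ∷ x) w = (if u ≟w w then c else + 0) ℤ.+ coeff x w

infix 4 _≈_
_≈_ : S → S → Set
x ≈ y = ∀ w → coeff x w ≡ coeff y w

gen : Word → S
gen u = (+ 1 , u) ∷ []

one : S
one = gen []

_✶_ : S → S → S
x ✶ y = concatMap (λ { (c , u) →
          concatMap (λ { (d , v) → map (λ w → (c ℤ.* d , w)) (u ⊛ v) }) y }) x

_^✶_ : S → ℕ → S
α ^✶ zero = one
α ^✶ suc k = α ✶ (α ^✶ k)

tuples : ℕ → ℕ → List (List ℕ)
tuples zero m = [] ∷ []
tuples (suc l) m = concatMap (λ a → map (suc a ∷_) (tuples l m)) (upTo m)

-- tuples (a₁,…,a_l) with aᵢ > 0 and a₁+⋯+a_l = k  (each aᵢ ≤ k automatically)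
compositionsOfLength : ℕ → ℕ → List (List ℕ)
compositionsOfLength k l = filter (λ as → sum as ℕ.≟ k) (tuples l k)

prodFact : List ℕ → ℕ
prodFact [] = 1
prodFact (a ∷ as) = a ! ℕ.* prodFact as

prodFact≢0 : ∀ as → NonZero (prodFact as)
prodFact≢0 [] = _
prodFact≢0 (a ∷ as) = m*n≢0 (a !) (prodFact as) {{a !≢0}} {{prodFact≢0 as}}

multinomial : ℕ → List ℕ → ℕ
multinomial k as = (k ! / prodFact as) {{prodFact≢0 as}}

compositionSum : ℕ → (ℕ → ℤ) → S
compositionSum k f =
  concatMap (λ l → map (λ as → (+ multinomial k as , map f as))
                       (compositionsOfLength k l))
            (map suc (upTo k))

posTerm : ℕ → ℕ → ℤ
posTerm r a = + (r ℕ.* a)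

tildeTerm : ℕ → ℕ → ℤ
tildeTerm r a = if does (2 ∣? a) then + (r ℕ.* a) else - (+ (r ℕ.* a))

module Submission where

-- A composition (c₁,…,c_l) is encoded by (c₁-1,…,c_l-1), so every list of
-- naturals is a composition.  If p(φ 1, φ a) = φ (a+1), then (φ 1) ∗ word(as)
-- is the sum of the words of the compositions 'ins as' obtained by inserting a
-- part 1 or raising a part by 1; hence (φ 1)^{∗k} is the sum, with coefficient
-- 1, of the words of 'powerTerms k'.  Counting through the reverse step 'del'
-- (mult-ins-del, double counting) gives count_{k+1}(bs) = Σ_{as ∈ del bs}
-- count_k(as), a recursion also satisfied by k!/∏ cᵢ! (del-weighted-sum), so
-- count_k(bs) is the multinomial coefficient.  The right-hand side lists each
-- composition of k once with weight k!/∏ cᵢ!.  Equal weighted multiplicities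
-- give equal elements of 𝒮 after the injective map bs ↦ word bs ('transfer').
-- The letters r a and \widetilde{r a} are signed multiples of r whose signs
-- are compatible with p, which supplies the hypotheses on φ.

open import Defs
open import Data.Nat using (ℕ; suc)
open import Data.Integer using (+_; -_)
open import Data.List using (_∷_; [])
open import Data.Product using (_×_)

open import Data.Nat as ℕ using (zero; _+_; _*_; _<_; _≤_; _!; NonZero; s≤s)
import Data.Nat.Properties as ℕP
open import Data.Nat.Instances
open import Data.Nat.ListAction using (sum)
open import Data.Nat.ListAction.Properties using (sum-++)
open import Data.Nat.Divisibility using (_∣_; ∣-refl; ∣-trans; *-monoʳ-∣; _∣?_)
open import Data.Nat.Combinatorics using (k![n∸k]!∣n!)
open import Data.Nat.DivMod using (_/_; m*n/n≡m; m/n*n≡m)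
open import Data.Nat.Tactic.RingSolver using (solve-∀)
open import Data.Integer as ℤ using (ℤ; _◃_; sign; ∣_∣)
import Data.Integer.Properties as ℤP
open import Data.Integer.Instances
open import Data.Sign as Sign using (Sign; opposite)
open import Data.Sign.Properties using (opposite-involutive)
open import Data.List as List using (List; _++_; map; concatMap; filter; upTo; length)
open import Data.List.Properties
  using (map-++; map-∘; map-cong; concatMap-cong; concatMap-map; map-concatMap; map-upTo; ++-identityʳ;
         map-injective; ∷-injectiveˡ; ∷-injectiveʳ)
open import Data.List.Instances
open import Data.List.Relation.Unary.All as All using (All)
open import Data.List.Relation.Unary.All.Properties using (¬Any⇒All¬; ++⁻)
open import Data.List.Relation.Unary.Any using (any?; satisfied)
open import Data.Product using (_,_)
open import Data.Bool using (true; false; if_then_else_)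
open import Function using (_∘_)
open import Function.Definitions using (Injective)
open import Relation.Binary.TypeClasses using (IsDecEquivalence; _≟_)
open import Relation.Binary.PropositionalEquality
open import Relation.Nullary using (Dec; yes; no; ¬_)
open import Relation.Nullary.Decidable using (does; dec-true; dec-false)
open import Relation.Unary using (Pred; Decidable)

open ≡-Reasoning

sum-zero : ∀ {A : Set} (f : A → ℕ) xs → (∀ x → f x ≡ 0) → sum (map f xs) ≡ 0
sum-zero f []       f≡0 = refl
sum-zero f (x ∷ xs) f≡0 = cong₂ _+_ (f≡0 x) (sum-zero f xs f≡0)

sum-cong : ∀ {A : Set} {f g : A → ℕ} → (∀ x → f x ≡ g x) → ∀ xs → sum (map f xs) ≡ sum (map g xs)
sum-cong f≗g xs = cong sum (map-cong f≗g xs)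

sum-map-+ : ∀ {A : Set} (f g : A → ℕ) xs →
            sum (map (λ x → f x + g x) xs) ≡ sum (map f xs) + sum (map g xs)
sum-map-+ f g []       = refl
sum-map-+ f g (x ∷ xs) = trans (cong (_+_ (f x + g x)) (sum-map-+ f g xs)) (interchange (f x) (g x) _ _)
  where
  interchange : ∀ a b c d → a + b + (c + d) ≡ a + c + (b + d)
  interchange = solve-∀

sum-map-*ʳ : ∀ {A : Set} (f : A → ℕ) c xs → sum (map (λ x → f x * c) xs) ≡ sum (map f xs) * c
sum-map-*ʳ f c []       = refl
sum-map-*ʳ f c (x ∷ xs) =
  trans (cong (_+_ (f x * c)) (sum-map-*ʳ f c xs)) (sym (ℕP.*-distribʳ-+ c (f x) _))

sum-map-++ : ∀ {A : Set} (f : A → ℕ) xs ys → sum (map f (xs ++ ys)) ≡ sum (map f xs) + sum (map f ys)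
sum-map-++ f xs ys = trans (cong sum (map-++ f xs ys)) (sum-++ (map f xs) (map f ys))

sum-map-map : ∀ {A B : Set} (f : B → ℕ) (g : A → B) xs → sum (map f (map g xs)) ≡ sum (map (f ∘ g) xs)
sum-map-map f g xs = cong sum (sym (map-∘ xs))

filter-map : ∀ {A B : Set} {ℓ} {P : Pred B ℓ} (P? : Decidable P) (f : A → B) xs →
             filter P? (map f xs) ≡ map f (filter (P? ∘ f) xs)
filter-map P? f [] = refl
filter-map P? f (x ∷ xs) with does (P? (f x))
... | true  = cong (f x ∷_) (filter-map P? f xs)
... | false = filter-map P? f xs

module _ {A : Set} {{_ : IsDecEquivalence {A = A} _≡_}} where

  δ : A → A → ℕ
  δ x y = if does (x ≟ y) then 1 else 0

  δ-≡ : ∀ {x y} → x ≡ y → δ x y ≡ 1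
  δ-≡ {x} {y} x≡y = cong (if_then 1 else 0) (dec-true (x ≟ y) x≡y)

  δ-≢ : ∀ {x y} → x ≢ y → δ x y ≡ 0
  δ-≢ {x} {y} x≢y = cong (if_then 1 else 0) (dec-false (x ≟ y) x≢y)

  δ-sym : ∀ x y → δ x y ≡ δ y x
  δ-sym x y = by-cases (x ≟ y)
    where
    by-cases : Dec (x ≡ y) → δ x y ≡ δ y x
    by-cases (yes x≡y) = trans (δ-≡ x≡y) (sym (δ-≡ (sym x≡y)))
    by-cases (no x≢y)  = trans (δ-≢ x≢y) (sym (δ-≢ (x≢y ∘ sym)))

  mult : A → List A → ℕ
  mult x ys = sum (map (λ y → δ y x) ys)

  mult-++ : ∀ x ys zs → mult x (ys ++ zs) ≡ mult x ys + mult x zs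
  mult-++ x ys zs = sum-map-++ (λ y → δ y x) ys zs

  mult-concatMap : ∀ {B : Set} x (g : B → List A) ys →
                   mult x (concatMap g ys) ≡ sum (map (λ y → mult x (g y)) ys)
  mult-concatMap x g []       = refl
  mult-concatMap x g (y ∷ ys) = trans (mult-++ x (g y) _) (cong (_+_ (mult x (g y))) (mult-concatMap x g ys))

  mult-swap : ∀ xs ys → sum (map (λ y → mult y xs) ys) ≡ sum (map (λ x → mult x ys) xs)
  mult-swap xs []       = sym (sum-zero (λ x → mult x []) xs (λ _ → refl))
  mult-swap xs (y ∷ ys) = begin
    mult y xs + sum (map (λ y′ → mult y′ xs) ys)
      ≡⟨ cong (_+_ (mult y xs)) (mult-swap xs ys) ⟩
    sum (map (λ x → δ x y) xs) + sum (map (λ x → mult x ys) xs)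
      ≡⟨ sym (sum-map-+ (λ x → δ x y) (λ x → mult x ys) xs) ⟩
    sum (map (λ x → δ x y + mult x ys) xs)
      ≡⟨ sum-cong (λ x → cong (_+ mult x ys) (δ-sym x y)) xs ⟩
    sum (map (λ x → mult x (y ∷ ys)) xs) ∎

  mult-map-injective : ∀ {f : A → A} → Injective _≡_ _≡_ f → ∀ x ys → mult (f x) (map f ys) ≡ mult x ys
  mult-map-injective f-inj x []       = refl
  mult-map-injective {f} f-inj x (y ∷ ys) = cong₂ _+_ (by-cases (y ≟ x)) (mult-map-injective f-inj x ys)
    where
    by-cases : Dec (y ≡ x) → δ (f y) (f x) ≡ δ y x
    by-cases (yes y≡x) = trans (δ-≡ (cong f y≡x)) (sym (δ-≡ y≡x))
    by-cases (no y≢x)  = trans (δ-≢ (y≢x ∘ f-inj)) (sym (δ-≢ y≢x))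

  mult-map-outside : ∀ {f : A → A} {x} → (∀ y → f y ≢ x) → ∀ ys → mult x (map f ys) ≡ 0
  mult-map-outside {f} {x} outside ys =
    trans (sum-map-map (λ z → δ z x) f ys) (sum-zero _ ys (λ y → δ-≢ (outside y)))

  module _ {ℓ} {P : Pred A ℓ} (P? : Decidable P) where

    mult-filter-accept : ∀ {x} → P x → ∀ ys → mult x (filter P? ys) ≡ mult x ys
    mult-filter-accept px [] = refl
    mult-filter-accept {x} px (y ∷ ys) with P? y
    ... | yes _  = cong (_+_ (δ y x)) (mult-filter-accept px ys)
    ... | no ¬py = trans (mult-filter-accept px ys)
                         (cong (_+ mult x ys) (sym (δ-≢ λ y≡x → ¬py (subst P (sym y≡x) px))))

    mult-filter-reject : ∀ {x} → ¬ P x → ∀ ys → mult x (filter P? ys) ≡ 0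
    mult-filter-reject ¬px [] = refl
    mult-filter-reject {x} ¬px (y ∷ ys) with P? y
    ... | yes py = cong₂ _+_ (δ-≢ λ y≡x → ¬px (subst P y≡x py)) (mult-filter-reject ¬px ys)
    ... | no _   = mult-filter-reject ¬px ys

upTo-suc : ∀ m → upTo (suc m) ≡ 0 ∷ map suc (upTo m)
upTo-suc m = cong (0 ∷_) (sym (map-upTo suc m))

mult-upTo : ∀ {b m} → b < m → mult b (upTo m) ≡ 1
mult-upTo {zero}  {suc m} _ =
  trans (cong (mult 0) (upTo-suc m)) (cong suc (mult-map-outside (λ _ ()) (upTo m)))
mult-upTo {suc b} {suc m} (s≤s b<m) =
  trans (cong (mult (suc b)) (upTo-suc m))
        (trans (mult-map-injective ℕP.suc-injective b (upTo m)) (mult-upTo b<m))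

-- Compositions.  The list bs = (b₁,…,b_l) encodes the composition
-- (b₁+1,…,b_l+1) of its size.

Composition : Set
Composition = List ℕ

parts : Composition → List ℕ
parts = map suc

size : Composition → ℕ
size bs = sum (parts bs)

-- one step of (1) ∗ _ : insert a new part 1 anywhere, or raise a part by 1
ins : Composition → List Composition
ins []       = (0 ∷ []) ∷ []
ins (a ∷ as) = (0 ∷ a ∷ as) ∷ (map (a ∷_) (ins as) ++ (suc a ∷ as) ∷ [])

-- the reverse step: remove a part 1, or lower a part ≥ 2 by 1
del : Composition → List Composition
del []           = []
del (zero ∷ bs)  = bs ∷ map (zero ∷_) (del bs)
del (suc b ∷ bs) = map (suc b ∷_) (del bs) ++ (b ∷ bs) ∷ []

mult-map-∷ : ∀ a b bs (cs : List Composition) → mult (b ∷ bs) (map (a ∷_) cs) ≡ δ a b * mult bs cs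
mult-map-∷ a b bs cs with a ≟ b
... | yes refl rewrite δ-≡ (refl {x = a}) =
  trans (mult-map-injective ∷-injectiveʳ bs cs) (sym (ℕP.*-identityˡ _))
... | no a≢b rewrite δ-≢ a≢b = mult-map-outside (λ _ e → a≢b (∷-injectiveˡ e)) cs

mult-[]-map-∷ : ∀ a (cs : List Composition) → mult [] (map (a ∷_) cs) ≡ 0
mult-[]-map-∷ a = mult-map-outside (λ _ ())

mult-ins-del : ∀ as bs → mult bs (ins as) ≡ mult as (del bs)
mult-ins-del [] [] = refl
mult-ins-del [] (zero ∷ bs) =
  cong₂ _+_ (δ-sym [] bs) (sym (mult-[]-map-∷ 0 (del bs)))
mult-ins-del [] (suc b ∷ bs) =
  sym (trans (mult-++ [] (map (suc b ∷_) (del bs)) _) (cong (_+ 0) (mult-[]-map-∷ (suc b) (del bs))))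
mult-ins-del (a ∷ as) [] =
  trans (mult-++ [] (map (a ∷_) (ins as)) _) (cong (_+ 0) (mult-[]-map-∷ a (ins as)))
mult-ins-del (a ∷ as) (zero ∷ bs) = begin
  δ (a ∷ as) bs + mult (0 ∷ bs) (map (a ∷_) (ins as) ++ (suc a ∷ as) ∷ [])
    ≡⟨ cong (_+_ (δ (a ∷ as) bs)) (mult-++ (0 ∷ bs) (map (a ∷_) (ins as)) _) ⟩
  δ (a ∷ as) bs + (mult (0 ∷ bs) (map (a ∷_) (ins as)) + 0)
    ≡⟨ cong₂ _+_ (δ-sym (a ∷ as) bs) (trans (ℕP.+-identityʳ _) (mult-map-∷ a 0 bs (ins as))) ⟩
  δ bs (a ∷ as) + δ a 0 * mult bs (ins as)
    ≡⟨ cong₂ (λ d n → δ bs (a ∷ as) + d * n) (δ-sym a 0) (mult-ins-del as bs) ⟩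
  δ bs (a ∷ as) + δ 0 a * mult as (del bs)
    ≡⟨ cong (_+_ (δ bs (a ∷ as))) (sym (mult-map-∷ 0 a as (del bs))) ⟩
  mult (a ∷ as) (del (zero ∷ bs)) ∎
mult-ins-del (a ∷ as) (suc b ∷ bs) = begin
  mult (suc b ∷ bs) (map (a ∷_) (ins as) ++ (suc a ∷ as) ∷ [])
    ≡⟨ mult-++ (suc b ∷ bs) (map (a ∷_) (ins as)) _ ⟩
  mult (suc b ∷ bs) (map (a ∷_) (ins as)) + (δ (a ∷ as) (b ∷ bs) + 0)
    ≡⟨ cong₂ _+_ (mult-map-∷ a (suc b) bs (ins as)) (cong (_+ 0) (δ-sym (a ∷ as) (b ∷ bs))) ⟩
  δ a (suc b) * mult bs (ins as) + (δ (b ∷ bs) (a ∷ as) + 0)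
    ≡⟨ cong₂ (λ d n → d * n + (δ (b ∷ bs) (a ∷ as) + 0)) (δ-sym a (suc b)) (mult-ins-del as bs) ⟩
  δ (suc b) a * mult as (del bs) + (δ (b ∷ bs) (a ∷ as) + 0)
    ≡⟨ cong (_+ (δ (b ∷ bs) (a ∷ as) + 0)) (sym (mult-map-∷ (suc b) a as (del bs))) ⟩
  mult (a ∷ as) (map (suc b ∷_) (del bs)) + mult (a ∷ as) ((b ∷ bs) ∷ [])
    ≡⟨ sym (mult-++ (a ∷ as) (map (suc b ∷_) (del bs)) _) ⟩
  mult (a ∷ as) (del (suc b ∷ bs)) ∎

fact : Composition → ℕ
fact bs = prodFact (parts bs)

fact≢0 : ∀ bs → NonZero (fact bs)
fact≢0 bs = prodFact≢0 (parts bs)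

prodFact∣ : ∀ as → prodFact as ∣ sum as !
prodFact∣ []       = ∣-refl
prodFact∣ (a ∷ as) = ∣-trans (*-monoʳ-∣ (a !) (prodFact∣ as)) a!s!∣[a+s]!
  where
  a!s!∣[a+s]! : a ! * sum as ! ∣ (a + sum as) !
  a!s!∣[a+s]! = subst (λ s → a ! * s ! ∣ (a + sum as) !) (ℕP.m+n∸m≡n a (sum as))
                      (k![n∸k]!∣n! (ℕP.m≤m+n a (sum as)))

multinomial-spec : ∀ k as → sum as ≡ k → multinomial k as * prodFact as ≡ k !
multinomial-spec k as refl = m/n*n≡m {{prodFact≢0 as}} (prodFact∣ as)

multinomialCoeff : ℕ → Composition → ℕ
multinomialCoeff k bs = δ (size bs) k * multinomial k (parts bs)

multinomialCoeff-of-size : ∀ {k bs} → size bs ≡ k → multinomialCoeff k bs ≡ multinomial k (parts bs)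
multinomialCoeff-of-size e rewrite δ-≡ e = ℕP.*-identityˡ _

multinomialCoeff-other : ∀ {k bs} → size bs ≢ k → multinomialCoeff k bs ≡ 0
multinomialCoeff-other e rewrite δ-≢ e = refl

-- the hypothesis of del-weighted-sum passes to the tail, absorbing the
-- factorial of the head part into the scale
tail-hyp : ∀ {x bs} (f : Composition → ℕ) c m →
           (∀ as → suc (size as) ≡ size (x ∷ bs) → f as * (m * fact as) ≡ c) →
           ∀ as → suc (size as) ≡ size bs → f (x ∷ as) * ((m * suc x !) * fact as) ≡ c
tail-hyp {x} {bs} f c m h as e =
  trans (cong (f (x ∷ as) *_) (ℕP.*-assoc m (suc x !) (fact as)))
        (h (x ∷ as) (trans (sym (ℕP.+-suc (suc x) (size as))) (cong (_+_ (suc x)) e)))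

-- The weighted count of reverse steps: if f as · m · ∏(parts of as)! = c for
-- every composition as one smaller than bs, then summing f over del bs gives
-- c · size bs after scaling by m · ∏(parts of bs)!.  (Removing a part 1 keeps
-- the product of factorials, lowering a part c ≥ 2 divides it by c.)
del-weighted-sum : ∀ bs (f : Composition → ℕ) c m →
                   (∀ as → suc (size as) ≡ size bs → f as * (m * fact as) ≡ c) →
                   sum (map f (del bs)) * (m * fact bs) ≡ c * size bs
del-weighted-sum [] f c m h = sym (ℕP.*-zeroʳ c)
del-weighted-sum (zero ∷ bs) f c m h = begin
  (f bs + sum (map f (map (0 ∷_) (del bs)))) * (m * (1 * fact bs))
    ≡⟨ cong (λ s → (f bs + s) * (m * (1 * fact bs))) (sum-map-map f (0 ∷_) (del bs)) ⟩
  (f bs + R) * (m * (1 * fact bs))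
    ≡⟨ split (f bs) R m (fact bs) ⟩
  f bs * (m * fact bs) + R * ((m * 1) * fact bs)
    ≡⟨ cong₂ _+_ (h bs refl) (del-weighted-sum bs (f ∘ (0 ∷_)) c (m * 1) (tail-hyp {0} {bs} f c m h)) ⟩
  c + c * size bs
    ≡⟨ sym (ℕP.*-suc c (size bs)) ⟩
  c * suc (size bs) ∎
  where
  R = sum (map (f ∘ (0 ∷_)) (del bs))
  split : ∀ F R m P → (F + R) * (m * (1 * P)) ≡ F * (m * P) + R * ((m * 1) * P)
  split = solve-∀
del-weighted-sum (suc b ∷ bs) f c m h = begin
  sum (map f (map (suc b ∷_) (del bs) ++ (b ∷ bs) ∷ [])) * (m * (B * q * fact bs))
    ≡⟨ cong (_* (m * (B * q * fact bs))) (sum-map-++ f (map (suc b ∷_) (del bs)) _) ⟩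
  (sum (map f (map (suc b ∷_) (del bs))) + (f (b ∷ bs) + 0)) * (m * (B * q * fact bs))
    ≡⟨ cong (λ s → (s + (f (b ∷ bs) + 0)) * (m * (B * q * fact bs))) (sum-map-map f (suc b ∷_) (del bs)) ⟩
  (R + (f (b ∷ bs) + 0)) * (m * (B * q * fact bs))
    ≡⟨ split R (f (b ∷ bs)) m B q (fact bs) ⟩
  R * ((m * (B * q)) * fact bs) + B * (f (b ∷ bs) * (m * (q * fact bs)))
    ≡⟨ cong₂ _+_ (del-weighted-sum bs (f ∘ (suc b ∷_)) c (m * (B * q)) (tail-hyp {suc b} {bs} f c m h))
                 (cong (B *_) (h (b ∷ bs) refl)) ⟩
  c * size bs + B * c
    ≡⟨ collect c (size bs) B ⟩
  c * (B + size bs) ∎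
  where
  B = suc (suc b)
  q = suc b !
  R = sum (map (f ∘ (suc b ∷_)) (del bs))
  split : ∀ R F m B q P →
          (R + (F + 0)) * (m * (B * q * P)) ≡ R * ((m * (B * q)) * P) + B * (F * (m * (q * P)))
  split = solve-∀
  collect : ∀ c s B → c * s + B * c ≡ c * (B + s)
  collect = solve-∀

multinomialCoeff-del : ∀ k bs → sum (map (multinomialCoeff k) (del bs)) ≡ multinomialCoeff (suc k) bs
multinomialCoeff-del k bs with size bs ≟ suc k
... | yes size≡ = begin
  Σ                        ≡⟨ sym (m*n/n≡m Σ (fact bs)) ⟩
  (Σ * fact bs) / fact bs  ≡⟨ cong (_/ fact bs) Σ*fact ⟩
  suc k ! / fact bs        ≡⟨ sym (multinomialCoeff-of-size {suc k} {bs} size≡) ⟩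
  multinomialCoeff (suc k) bs ∎
  where
  instance _ = fact≢0 bs
  Σ = sum (map (multinomialCoeff k) (del bs))
  term : ∀ as → suc (size as) ≡ size bs → multinomialCoeff k as * (1 * fact as) ≡ k !
  term as e = begin
    multinomialCoeff k as * (1 * fact as)
      ≡⟨ cong₂ _*_ (multinomialCoeff-of-size {k} {as} size-as) (ℕP.*-identityˡ _) ⟩
    multinomial k (parts as) * fact as
      ≡⟨ multinomial-spec k (parts as) size-as ⟩
    k ! ∎
    where size-as = ℕP.suc-injective (trans e size≡)
  Σ*fact : Σ * fact bs ≡ suc k !
  Σ*fact = begin
    Σ * fact bs       ≡⟨ cong (Σ *_) (sym (ℕP.*-identityˡ _)) ⟩
    Σ * (1 * fact bs) ≡⟨ del-weighted-sum bs (multinomialCoeff k) (k !) 1 term ⟩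
    k ! * size bs     ≡⟨ cong (k ! *_) size≡ ⟩
    k ! * suc k       ≡⟨ ℕP.*-comm (k !) (suc k) ⟩
    suc k ! ∎
... | no size≢ = begin
  Σ                           ≡⟨ ℕP.m*n≡0⇒m≡0 Σ (fact bs) Σ*fact≡0 ⟩
  0                           ≡⟨ sym (multinomialCoeff-other {suc k} {bs} size≢) ⟩
  multinomialCoeff (suc k) bs ∎
  where
  instance _ = fact≢0 bs
  Σ = sum (map (multinomialCoeff k) (del bs))
  term : ∀ as → suc (size as) ≡ size bs → multinomialCoeff k as * (1 * fact as) ≡ 0
  term as e = cong (_* (1 * fact as))
                   (multinomialCoeff-other {k} {as} λ size-as → size≢ (trans (sym e) (cong suc size-as)))
  Σ*fact≡0 : Σ * fact bs ≡ 0
  Σ*fact≡0 = trans (cong (Σ *_) (sym (ℕP.*-identityˡ _))) (del-weighted-sum bs (multinomialCoeff k) 0 1 term)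

-- The compositions indexing the words of (1)^{∗k}, with repetition.
powerTerms : ℕ → List Composition
powerTerms zero    = [] ∷ []
powerTerms (suc k) = concatMap ins (powerTerms k)

mult-powerTerms : ∀ k bs → mult bs (powerTerms k) ≡ multinomialCoeff k bs
mult-powerTerms zero []       = refl
mult-powerTerms zero (b ∷ bs) = refl
mult-powerTerms (suc k) bs = begin
  mult bs (concatMap ins (powerTerms k))             ≡⟨ mult-concatMap bs ins (powerTerms k) ⟩
  sum (map (λ as → mult bs (ins as)) (powerTerms k)) ≡⟨ sum-cong (λ as → mult-ins-del as bs) (powerTerms k) ⟩
  sum (map (λ as → mult as (del bs)) (powerTerms k)) ≡⟨ mult-swap (del bs) (powerTerms k) ⟩
  sum (map (λ as → mult as (powerTerms k)) (del bs)) ≡⟨ sum-cong (mult-powerTerms k) (del bs) ⟩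
  sum (map (multinomialCoeff k) (del bs))            ≡⟨ multinomialCoeff-del k bs ⟩
  multinomialCoeff (suc k) bs ∎

shiftedTuples : ℕ → ℕ → List Composition
shiftedTuples zero    m = [] ∷ []
shiftedTuples (suc l) m = concatMap (λ a → map (a ∷_) (shiftedTuples l m)) (upTo m)

tuples-shift : ∀ l m → tuples l m ≡ map parts (shiftedTuples l m)
tuples-shift zero    m = refl
tuples-shift (suc l) m = begin
  concatMap (λ a → map (suc a ∷_) (tuples l m)) (upTo m)
    ≡⟨ concatMap-cong (λ a → cong (map (suc a ∷_)) (tuples-shift l m)) (upTo m) ⟩
  concatMap (λ a → map (suc a ∷_) (map parts (shiftedTuples l m))) (upTo m)
    ≡⟨ concatMap-cong (λ a → trans (sym (map-∘ (shiftedTuples l m))) (map-∘ (shiftedTuples l m))) (upTo m) ⟩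
  concatMap (λ a → map parts (map (a ∷_) (shiftedTuples l m))) (upTo m)
    ≡⟨ sym (map-concatMap parts (λ a → map (a ∷_) (shiftedTuples l m)) (upTo m)) ⟩
  map parts (shiftedTuples (suc l) m) ∎

mult-shiftedTuples : ∀ l m bs → All (_< m) bs → mult bs (shiftedTuples l m) ≡ δ l (length bs)
mult-shiftedTuples zero    m []       _ = refl
mult-shiftedTuples zero    m (b ∷ bs) _ = refl
mult-shiftedTuples (suc l) m []       _ =
  trans (mult-concatMap [] _ (upTo m)) (sum-zero _ (upTo m) (λ a → mult-[]-map-∷ a (shiftedTuples l m)))
mult-shiftedTuples (suc l) m (b ∷ bs) (b<m All.∷ bs<m) = begin
  mult (b ∷ bs) (shiftedTuples (suc l) m)
    ≡⟨ mult-concatMap (b ∷ bs) _ (upTo m) ⟩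
  sum (map (λ a → mult (b ∷ bs) (map (a ∷_) (shiftedTuples l m))) (upTo m))
    ≡⟨ sum-cong (λ a → mult-map-∷ a b bs (shiftedTuples l m)) (upTo m) ⟩
  sum (map (λ a → δ a b * mult bs (shiftedTuples l m)) (upTo m))
    ≡⟨ sum-map-*ʳ (λ a → δ a b) _ (upTo m) ⟩
  mult b (upTo m) * mult bs (shiftedTuples l m)
    ≡⟨ cong₂ _*_ (mult-upTo b<m) (mult-shiftedTuples l m bs bs<m) ⟩
  1 * δ l (length bs)
    ≡⟨ ℕP.*-identityˡ _ ⟩
  δ (suc l) (length (b ∷ bs)) ∎

length≤size : ∀ bs → length bs ≤ size bs
length≤size []       = ℕ.z≤n
length≤size (b ∷ bs) = s≤s (ℕP.≤-trans (length≤size bs) (ℕP.m≤n+m (size bs) b))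

entries<size : ∀ bs → All (_< size bs) bs
entries<size []       = All.[]
entries<size (b ∷ bs) =
  s≤s (ℕP.m≤m+n b (size bs))
  All.∷ All.map (λ b′<s → ℕP.<-≤-trans b′<s (ℕP.m≤n+m (size bs) (suc b))) (entries<size bs)

compositions : ℕ → List Composition
compositions k = concatMap (λ l → filter (λ bs → size bs ≟ k) (shiftedTuples l k)) (map suc (upTo k))

mult-compositions-other : ∀ k bs → size bs ≢ k → mult bs (compositions k) ≡ 0
mult-compositions-other k bs size≢ =
  trans (mult-concatMap bs _ lengths)
        (sum-zero _ lengths (λ l → mult-filter-reject (λ cs → size cs ≟ k) size≢ (shiftedTuples l k)))
  where lengths = map suc (upTo k)

mult-compositions-of-size : ∀ k bs → size bs ≡ suc k → mult bs (compositions (suc k)) ≡ 1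
mult-compositions-of-size k []       ()
mult-compositions-of-size k (b ∷ bs) size≡ = begin
  mult (b ∷ bs) (compositions (suc k))
    ≡⟨ mult-concatMap (b ∷ bs) (λ l → filter (λ cs → size cs ≟ suc k) (shiftedTuples l (suc k))) lengths ⟩
  sum (map (λ l → mult (b ∷ bs) (filter (λ cs → size cs ≟ suc k) (shiftedTuples l (suc k)))) lengths)
    ≡⟨ sum-cong (λ l → mult-filter-accept (λ cs → size cs ≟ suc k) size≡ (shiftedTuples l (suc k))) lengths ⟩
  sum (map (λ l → mult (b ∷ bs) (shiftedTuples l (suc k))) lengths)
    ≡⟨ sum-cong (λ l → mult-shiftedTuples l (suc k) (b ∷ bs) entries<k) lengths ⟩
  mult (suc (length bs)) (map suc (upTo (suc k)))
    ≡⟨ mult-map-injective ℕP.suc-injective (length bs) (upTo (suc k)) ⟩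
  mult (length bs) (upTo (suc k))
    ≡⟨ mult-upTo (subst (length (b ∷ bs) ≤_) size≡ (length≤size (b ∷ bs))) ⟩
  1 ∎
  where
  lengths = map suc (upTo (suc k))
  entries<k = subst (λ n → All (_< n) (b ∷ bs)) size≡ (entries<size (b ∷ bs))

mult-compositions : ∀ k bs → mult bs (compositions (suc k)) ≡ δ (size bs) (suc k)
mult-compositions k bs with size bs ≟ suc k
... | yes size≡ = trans (mult-compositions-of-size k bs size≡) (sym (δ-≡ size≡))
... | no size≢  = trans (mult-compositions-other (suc k) bs size≢) (sym (δ-≢ size≢))

power-counts : ∀ k bs →
  1 * mult bs (powerTerms (suc k)) ≡ multinomial (suc k) (parts bs) * mult bs (compositions (suc k))
power-counts k bs rewrite mult-powerTerms (suc k) bs | mult-compositions k bs =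
  trans (ℕP.*-identityˡ _) (ℕP.*-comm (δ (size bs) (suc k)) _)

image : (Composition → ℕ) → (Composition → Word) → List Composition → S
image c f cs = map (λ bs → (+ c bs , f bs)) cs

≟w-does : ∀ u v → u ≟w v ≡ does (u ≟ v)
≟w-does []      []      = refl
≟w-does []      (_ ∷ _) = refl
≟w-does (_ ∷ _) []      = refl
≟w-does (a ∷ u) (b ∷ v) with a ℤ.≟ b
... | yes _ = ≟w-does u v
... | no _  = refl

coeff-image-hit : ∀ {f} → Injective _≡_ _≡_ f → ∀ c a cs → coeff (image c f cs) (f a) ≡ + (c a * mult a cs)
coeff-image-hit f-inj c a [] = cong +_ (sym (ℕP.*-zeroʳ (c a)))
coeff-image-hit {f} f-inj c a (y ∷ cs) = begin
  (if f y ≟w f a then + c y else + 0) ℤ.+ coeff (image c f cs) (f a)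
    ≡⟨ cong₂ ℤ._+_ (head-term (y ≟ a)) (coeff-image-hit f-inj c a cs) ⟩
  + (c a * δ y a) ℤ.+ + (c a * mult a cs)
    ≡⟨ sym (ℤP.pos-+ (c a * δ y a) _) ⟩
  + (c a * δ y a + c a * mult a cs)
    ≡⟨ cong +_ (sym (ℕP.*-distribˡ-+ (c a) (δ y a) _)) ⟩
  + (c a * mult a (y ∷ cs)) ∎
  where
  head-term : Dec (y ≡ a) → (if f y ≟w f a then + c y else + 0) ≡ + (c a * δ y a)
  head-term (yes refl) = begin
    (if f y ≟w f y then + c y else + 0)
      ≡⟨ cong (if_then + c y else + 0) (trans (≟w-does (f y) (f y)) (dec-true (f y ≟ f y) refl)) ⟩
    + c y                               ≡⟨ cong +_ (sym (ℕP.*-identityʳ (c y))) ⟩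
    + (c y * 1)                         ≡⟨ cong (λ d → + (c y * d)) (sym (δ-≡ (refl {x = y}))) ⟩
    + (c y * δ y y) ∎
  head-term (no y≢a) = begin
    (if f y ≟w f a then + c y else + 0)
      ≡⟨ cong (if_then + c y else + 0) (trans (≟w-does (f y) (f a)) (dec-false (f y ≟ f a) (y≢a ∘ f-inj))) ⟩
    + 0                                 ≡⟨ cong +_ (sym (ℕP.*-zeroʳ (c a))) ⟩
    + (c a * 0)                         ≡⟨ cong (λ d → + (c a * d)) (sym (δ-≢ y≢a)) ⟩
    + (c a * δ y a) ∎

coeff-image-miss : ∀ c f w cs → All (λ y → f y ≢ w) cs → coeff (image c f cs) w ≡ + 0
coeff-image-miss c f w []       All.[]           = refl
coeff-image-miss c f w (y ∷ cs) (fy≢w All.∷ miss)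
  rewrite ≟w-does (f y) w | dec-false (f y ≟ w) fy≢w | coeff-image-miss c f w cs miss = refl

transfer : ∀ {f} → Injective _≡_ _≡_ f → ∀ c d cs ds →
           (∀ bs → c bs * mult bs cs ≡ d bs * mult bs ds) → image c f cs ≈ image d f ds
transfer {f} f-inj c d cs ds counts w with any? (λ y → f y ≟ w) (cs ++ ds)
... | yes found with satisfied found
...   | a , refl = trans (coeff-image-hit f-inj c a cs)
                         (trans (cong +_ (counts a)) (sym (coeff-image-hit f-inj d a ds)))
transfer {f} f-inj c d cs ds counts w | no none
  with ++⁻ cs (¬Any⇒All¬ (cs ++ ds) none)
... | miss-cs , miss-ds = trans (coeff-image-miss c f w cs miss-cs) (sym (coeff-image-miss d f w ds miss-ds))

generator-product : ∀ u (f : Composition → Word) cs →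
  gen u ✶ image (λ _ → 1) f cs ≡ concatMap (λ bs → map (λ w → (+ 1 , w)) (u ⊛ f bs)) cs
generator-product u f cs = trans (++-identityʳ _) (concatMap-map _ _ cs)

module HarmonicPower (φ : ℕ → ℤ) (φ-injective : Injective _≡_ _≡_ φ)
                     (φ-merge : ∀ a → p (φ 1) (φ (suc a)) ≡ φ (suc (suc a))) where

  word : Composition → Word
  word bs = map φ (parts bs)

  word-injective : Injective _≡_ _≡_ word
  word-injective = map-injective ℕP.suc-injective ∘ map-injective φ-injective

  insert-word : ∀ bs → (φ 1 ∷ []) ⊛ word bs ≡ map word (ins bs)
  insert-word []       = refl
  insert-word (b ∷ bs) = cong ((φ 1 ∷ word (b ∷ bs)) ∷_) (begin
    map (φ (suc b) ∷_) ((φ 1 ∷ []) ⊛ word bs) ++ (p (φ 1) (φ (suc b)) ∷ word bs) ∷ []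
      ≡⟨ cong₂ (λ ws x → map (φ (suc b) ∷_) ws ++ (x ∷ word bs) ∷ []) (insert-word bs) (φ-merge b) ⟩
    map (φ (suc b) ∷_) (map word (ins bs)) ++ word (suc b ∷ bs) ∷ []
      ≡⟨ cong (_++ word (suc b ∷ bs) ∷ []) (trans (sym (map-∘ (ins bs))) (map-∘ (ins bs))) ⟩
    map word (map (b ∷_) (ins bs)) ++ map word ((suc b ∷ bs) ∷ [])
      ≡⟨ sym (map-++ word (map (b ∷_) (ins bs)) _) ⟩
    map word (map (b ∷_) (ins bs) ++ (suc b ∷ bs) ∷ []) ∎)

  power-image : ∀ k → gen (φ 1 ∷ []) ^✶ k ≡ image (λ _ → 1) word (powerTerms k)
  power-image zero    = refl
  power-image (suc k) = begin
    gen (φ 1 ∷ []) ✶ (gen (φ 1 ∷ []) ^✶ k)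
      ≡⟨ cong (gen (φ 1 ∷ []) ✶_) (power-image k) ⟩
    gen (φ 1 ∷ []) ✶ image (λ _ → 1) word (powerTerms k)
      ≡⟨ generator-product (φ 1 ∷ []) word (powerTerms k) ⟩
    concatMap (λ bs → map (λ w → (+ 1 , w)) ((φ 1 ∷ []) ⊛ word bs)) (powerTerms k)
      ≡⟨ concatMap-cong (λ bs → trans (cong (map _) (insert-word bs)) (sym (map-∘ (ins bs)))) (powerTerms k) ⟩
    concatMap (image (λ _ → 1) word ∘ ins) (powerTerms k)
      ≡⟨ sym (map-concatMap _ ins (powerTerms k)) ⟩
    image (λ _ → 1) word (powerTerms (suc k)) ∎

  compositionSum-image : ∀ k →
    compositionSum k φ ≡ image (λ bs → multinomial k (parts bs)) word (compositions k)
  compositionSum-image k = begin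
    concatMap (λ l → map h (filter (λ as → sum as ℕ.≟ k) (tuples l k))) lengths
      ≡⟨ concatMap-cong (λ l → cong (map h ∘ filter (λ as → sum as ℕ.≟ k)) (tuples-shift l k)) lengths ⟩
    concatMap (λ l → map h (filter (λ as → sum as ℕ.≟ k) (map parts (shiftedTuples l k)))) lengths
      ≡⟨ concatMap-cong (λ l → cong (map h) (filter-map (λ as → sum as ℕ.≟ k) parts (shiftedTuples l k)))
                        lengths ⟩
    concatMap (λ l → map h (map parts (filter (λ bs → size bs ≟ k) (shiftedTuples l k)))) lengths
      ≡⟨ concatMap-cong (λ l → sym (map-∘ (filter (λ bs → size bs ≟ k) (shiftedTuples l k)))) lengths ⟩
    concatMap (λ l → image c word (filter (λ bs → size bs ≟ k) (shiftedTuples l k))) lengths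
      ≡⟨ sym (map-concatMap _ _ lengths) ⟩
    image c word (compositions k) ∎
    where
    lengths = map suc (upTo k)
    h : List ℕ → ℤ × Word
    h as = (+ multinomial k as , map φ as)
    c : Composition → ℕ
    c bs = multinomial k (parts bs)

  harmonic-power : ∀ k → gen (φ 1 ∷ []) ^✶ suc k ≈ compositionSum (suc k) φ
  harmonic-power k =
    subst₂ _≈_ (sym (power-image (suc k))) (sym (compositionSum-image (suc k)))
           (transfer word-injective (λ _ → 1) (λ bs → multinomial (suc k) (parts bs))
                     (powerTerms (suc k)) (compositions (suc k)) (power-counts k))

module SignedMultiples (φ : ℕ → ℤ) (r : ℕ) {{_ : NonZero r}} (σ : ℕ → Sign)
                       (φ-form : ∀ a → φ a ≡ σ a ◃ (r * a))
                       (σ-merge : ∀ a → σ (suc (suc a)) ≡ σ 1 Sign.* σ (suc a)) where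

  abs-φ : ∀ a → ∣ φ a ∣ ≡ r * a
  abs-φ a = trans (cong ∣_∣ (φ-form a)) (ℤP.abs-◃ (σ a) (r * a))

  sign-φ : ∀ a → sign (φ (suc a)) ≡ σ (suc a)
  sign-φ a = trans (cong sign (φ-form (suc a))) (ℤP.sign-◃ (σ (suc a)) (r * suc a) {{ℕP.m*n≢0 r (suc a)}})

  -- |φ a| = r a determines a
  injective : Injective _≡_ _≡_ φ
  injective {a} {b} e = ℕP.*-cancelˡ-≡ a b r (trans (sym (abs-φ a)) (trans (cong ∣_∣ e) (abs-φ b)))

  -- p adds the absolute values and multiplies the signs
  merge : ∀ a → p (φ 1) (φ (suc a)) ≡ φ (suc (suc a))
  merge a = begin
    (sign (φ 1) Sign.* sign (φ (suc a))) ◃ (∣ φ 1 ∣ + ∣ φ (suc a) ∣)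
      ≡⟨ cong₂ _◃_ (cong₂ Sign._*_ (sign-φ 0) (sign-φ a)) (cong₂ _+_ (abs-φ 1) (abs-φ (suc a))) ⟩
    (σ 1 Sign.* σ (suc a)) ◃ (r * 1 + r * suc a)
      ≡⟨ cong₂ _◃_ (sym (σ-merge a)) (sym (ℕP.*-distribˡ-+ r 1 (suc a))) ⟩
    σ (suc (suc a)) ◃ (r * suc (suc a))
      ≡⟨ sym (φ-form (suc (suc a))) ⟩
    φ (suc (suc a)) ∎

posTerm-form : ∀ r a → posTerm r a ≡ Sign.+ ◃ (r * a)
posTerm-form r a = sym (ℤP.+◃n≡+n (r * a))

tildeSign : ℕ → Sign
tildeSign a = if does (2 ∣? a) then Sign.+ else Sign.-

tildeTerm-form : ∀ r a → tildeTerm r a ≡ tildeSign a ◃ (r * a)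
tildeTerm-form r a = signed (does (2 ∣? a)) (r * a)
  where
  signed : ∀ even n → (if even then + n else - (+ n)) ≡ (if even then Sign.+ else Sign.-) ◃ n
  signed true  n = sym (ℤP.+◃n≡+n n)
  signed false n = sym (ℤP.-◃n≡-n n)

tildeSign-suc : ∀ a → tildeSign (suc a) ≡ opposite (tildeSign a)
tildeSign-suc zero          = refl
tildeSign-suc (suc zero)    = refl
tildeSign-suc (suc (suc a)) = tildeSign-suc a

tildeSign-merge : ∀ a → tildeSign (suc (suc a)) ≡ Sign.- Sign.* tildeSign (suc a)
tildeSign-merge a = sym (trans (cong opposite (tildeSign-suc a)) (opposite-involutive (tildeSign a)))

lemma2p4 : (k r : ℕ) → 0 Data.Nat.< k → 0 Data.Nat.< r →
    (gen (+ r ∷ []) ^✶ k ≈ compositionSum k (posTerm r))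
    × (gen (- (+ r) ∷ []) ^✶ k ≈ compositionSum k (tildeTerm r))
lemma2p4 zero    _         () _
lemma2p4 (suc _) zero      _  ()
lemma2p4 (suc k) r@(suc _) _  _ = positive , negative
  where
  module Pos = SignedMultiples (posTerm r) r (λ _ → Sign.+) (posTerm-form r) (λ _ → refl)
  module Neg = SignedMultiples (tildeTerm r) r tildeSign (tildeTerm-form r) tildeSign-merge

  positive : gen (+ r ∷ []) ^✶ suc k ≈ compositionSum (suc k) (posTerm r)
  positive = subst (λ x → gen (x ∷ []) ^✶ suc k ≈ compositionSum (suc k) (posTerm r))
                   (cong +_ (ℕP.*-identityʳ r))
                   (HarmonicPower.harmonic-power (posTerm r) Pos.injective Pos.merge k)

  negative : gen (- (+ r) ∷ []) ^✶ suc k ≈ compositionSum (suc k) (tildeTerm r)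
  negative = subst (λ x → gen (- (+ x) ∷ []) ^✶ suc k ≈ compositionSum (suc k) (tildeTerm r))
                   (ℕP.*-identityʳ r)
                   (HarmonicPower.harmonic-power (tildeTerm r) Neg.injective Neg.merge k)
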